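{- (i) Let $A \subseteq \mathbb{N}$ have property $P$. Then $A$ has natural density $0$; equivalently, if $A = \{a_1 < a_2 < \dots\}$ is infinite, then $a_j/j \to \infty$ as $j \to \infty$. (ii) Conversely, for any function $f\colon \mathbb{N} \to \mathbb{N}$ with $f(j) \to \infty$ as $j \to \infty$, there exists an infinite strictly increasing sequence $A = \{a_1 < a_2 < \dots\}$ of natural numbers with property $P$ such that $a_j/j \le f(j)$ for all $j \in \mathbb{N}$.
   Context: $\mathrm{SF}$ denotes the set of squarefree positive integers, i.e. $\mathbb{N}$ minus all positive multiples of $p^2$ for primes $p$. A set $A \subseteq \mathbb{N}$ has property $P$ if for every $n \in \mathbb{N}$ there are only finitely many $a \in A$ with $n + a \in \mathrm{SF}$. For $x>0$, $[x] = \{n \in \mathbb{N} : n \le x\}$. The natural density of $A$ is $\lim_{x\to\infty} |A \cap [x]|/x$ when this limit exists. -}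

module Defs where

open import Data.Nat using (ℕ; zero; suc; _+_; _*_; _≤_; _<_)
open import Data.Nat.Divisibility using (_∣_)
open import Data.Nat.Primality using (Prime)
open import Data.Bool using (Bool; true; false; if_then_else_)
open import Data.Product using (_×_; ∃)
open import Relation.Nullary using (¬_)

-- ℕ in the paper = positive integers; we use Agda ℕ and restrict to m ≥ 1 where needed.

SF : ℕ → Set
SF m = 1 ≤ m × (∀ p → Prime p → ¬ (p * p ∣ m))

-- property P for a set A ⊆ ℕ (given as a predicate; only positive elements count):
-- for every n ≥ 1, only finitely many a ∈ A with n + a ∈ SF
HasP : (ℕ → Set) → Set
HasP A = ∀ n → 1 ≤ n → ∃ λ B → ∀ a → A a → 1 ≤ a → SF (n + a) → a ≤ B

count : (ℕ → Bool) → ℕ → ℕ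
count A zero = 0
count A (suc x) = (if A (suc x) then 1 else 0) + count A x

-- natural density 0: |A ∩ [x]| / x → 0, i.e. for every k ≥ 1 eventually |A ∩ [x]| ≤ x / k
Density0 : (ℕ → Bool) → Set
Density0 A = ∀ k → 1 ≤ k → ∃ λ X → ∀ x → X ≤ x → k * count A x ≤ x

TendsToInfinity : (ℕ → ℕ) → Set
TendsToInfinity f = ∀ M → ∃ λ J → ∀ j → J ≤ j → M ≤ f j

{-# OPTIONS --safe #-}
module Submission where

-- (i) Beyond the threshold B = Σ_{n ≤ N} (bound for n from property P), every a ∈ A has a + 1, …, a + N
-- all non-squarefree, each divisible by some (2 + d)². For a single a the small squares (d < D) cover at
-- most Σ_d N/(2 + d)² + D ≤ 3N/4 + D of these shifts, while the large squares (d ≥ D), summed over all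
-- a ≤ x, occur at most N (N + x)/(D + 1) times. With N = 8 (D + 1) the number of such a ≤ x is therefore
-- at most 8 (N + x)/(D + 1), and D is arbitrary.
-- (ii) With M₀ = 1, M_{L+1} = M_L (M_L + 1)² one finds residues r_L such that n + r_L + t M_L is divisible
-- by (M_{n-1} + 1)² for all 1 ≤ n ≤ L and all t. The i-th term is the next element of the class r_L mod M_L
-- after the previous term, for a level L = L(i) that grows so slowly that the gap r_L + M_L stays below
-- f(j) for all j > i; since L(i) → ∞, every fixed n + a_i is eventually non-squarefree.

open import Defs
open import Data.Nat using (ℕ; zero; suc; _+_; _*_; _∸_; _≤_; _<_; _<ᵇ_; z≤n; s≤s; pred; NonZero; >-nonZero; >-nonZero⁻¹; nonTrivial⇒n>1)
open import Data.Nat.Properties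
open import Data.Nat.DivMod
open import Data.Nat.Divisibility
open import Data.Nat.Primality using (Prime; prime⇒nonTrivial)
open import Data.Nat.Primality.Factorisation using (factorise)
open import Data.Nat.ListAction using (product)
open import Data.Nat.Tactic.RingSolver using (solve-∀)
open import Data.List using ([]; _∷_)
open import Data.List.Relation.Unary.All using (_∷_)
open import Data.Bool using (Bool; true; false; T; _∧_)
open import Data.Bool.Properties using (T-∧)
open import Data.Unit using (tt)
open import Data.Product using (_×_; ∃; _,_; proj₁; proj₂)
open import Data.Sum using (_⊎_; inj₁; inj₂)
open import Data.Empty using (⊥-elim)
open import Function using (_∘_)
open import Function.Bundles using (Equivalence)
open import Relation.Nullary using (¬_; yes; no)
open import Relation.Unary using (Decidable)
open import Relation.Binary.PropositionalEquality

∑< : ℕ → (ℕ → ℕ) → ℕ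
∑< zero    f = 0
∑< (suc n) f = ∑< n f + f n

infix 6.5 ∑<
syntax ∑< n (λ i → e) = ∑[ i < n ] e

∑-cong : ∀ n {f g : ℕ → ℕ} → (∀ i → i < n → f i ≡ g i) → ∑< n f ≡ ∑< n g
∑-cong zero    f≡g = refl
∑-cong (suc n) f≡g = cong₂ _+_ (∑-cong n (λ i i<n → f≡g i (m<n⇒m<1+n i<n))) (f≡g n ≤-refl)

∑-mono-≤ : ∀ n {f g : ℕ → ℕ} → (∀ i → i < n → f i ≤ g i) → ∑< n f ≤ ∑< n g
∑-mono-≤ zero    f≤g = z≤n
∑-mono-≤ (suc n) f≤g = +-mono-≤ (∑-mono-≤ n (λ i i<n → f≤g i (m<n⇒m<1+n i<n))) (f≤g n ≤-refl)

∑-distrib-+ : ∀ n (f g : ℕ → ℕ) → ∑[ i < n ] (f i + g i) ≡ ∑< n f + ∑< n g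
∑-distrib-+ zero    f g = refl
∑-distrib-+ (suc n) f g =
  trans (cong (_+ (f n + g n)) (∑-distrib-+ n f g)) (interchange (∑< n f) (∑< n g) (f n) (g n))
  where
  interchange : ∀ a b c d → a + b + (c + d) ≡ a + c + (b + d)
  interchange = solve-∀

∑-const : ∀ n c → ∑[ _ < n ] c ≡ n * c
∑-const zero    c = refl
∑-const (suc n) c = trans (cong (_+ c) (∑-const n c)) (+-comm (n * c) c)

∑-split : ∀ m n (f : ℕ → ℕ) → ∑< (m + n) f ≡ ∑< m f + ∑[ i < n ] f (m + i)
∑-split m zero    f = trans (cong (λ k → ∑< k f) (+-identityʳ m)) (sym (+-identityʳ (∑< m f)))
∑-split m (suc n) f = begin
  ∑< (m + suc n) f                          ≡⟨ cong (λ k → ∑< k f) (+-suc m n) ⟩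
  ∑< (m + n) f + f (m + n)                  ≡⟨ cong (_+ f (m + n)) (∑-split m n f) ⟩
  ∑< m f + ∑[ i < n ] f (m + i) + f (m + n) ≡⟨ +-assoc (∑< m f) _ _ ⟩
  ∑< m f + ∑[ i < suc n ] f (m + i)         ∎
  where open ≡-Reasoning

term≤∑ : ∀ n (f : ℕ → ℕ) {i} → i < n → f i ≤ ∑< n f
term≤∑ (suc n) f {i} i<1+n with m≤n⇒m<n∨m≡n (≤-pred i<1+n)
... | inj₁ i<n  = ≤-trans (term≤∑ n f i<n) (m≤m+n (∑< n f) (f n))
... | inj₂ refl = m≤n+m (f i) (∑< n f)

∑-comm : ∀ m n (g : ℕ → ℕ → ℕ) → ∑[ i < m ] ∑< n (g i) ≡ ∑[ j < n ] ∑[ i < m ] g i j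
∑-comm zero    n g = sym (trans (∑-const n 0) (*-zeroʳ n))
∑-comm (suc m) n g = trans (cong (_+ ∑< n (g m)) (∑-comm m n g)) (sym (∑-distrib-+ n _ (g m)))

m<[1+m/n]*n : ∀ m n .{{_ : NonZero n}} → m < suc (m / n) * n
m<[1+m/n]*n m n = begin-strict
  m                   ≡⟨ m≡m%n+[m/n]*n m n ⟩
  m % n + (m / n) * n <⟨ +-monoˡ-< ((m / n) * n) (m%n<n m n) ⟩
  n + (m / n) * n     ∎
  where open ≤-Reasoning

[m+n]/o≤m/o+n/o+1 : ∀ m n o .{{_ : NonZero o}} → (m + n) / o ≤ m / o + n / o + 1
[m+n]/o≤m/o+n/o+1 m n o = ≤-pred (m<n*o⇒m/o<n (begin-strict
  m + n                                  <⟨ +-mono-< (m<[1+m/n]*n m o) (m<[1+m/n]*n n o) ⟩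
  suc (m / o) * o + suc (n / o) * o      ≡⟨ regroup (m / o) (n / o) o ⟩
  suc (m / o + n / o + 1) * o            ∎))
  where
  open ≤-Reasoning
  regroup : ∀ a b q → suc a * q + suc b * q ≡ suc (a + b + 1) * q
  regroup = solve-∀

-- For m ≥ 1 this is 1 if q ∣ m and 0 otherwise; written as a difference of floors, its sums over intervals telescope.
𝟙[_∣_] : (q : ℕ) .{{_ : NonZero q}} → ℕ → ℕ
𝟙[ q ∣ m ] = m / q ∸ pred m / q

∣⇒1≤𝟙[∣] : ∀ q .{{_ : NonZero q}} {m} → 1 ≤ m → q ∣ m → 1 ≤ 𝟙[ q ∣ m ]
∣⇒1≤𝟙[∣] q {suc m} _ (divides k 1+m≡k*q) =
  m<n⇒0<n∸m (subst (m / q <_) (sym 1+m/q≡k) (m<n*o⇒m/o<n (subst (m <_) 1+m≡k*q ≤-refl)))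
  where
  1+m/q≡k : suc m / q ≡ k
  1+m/q≡k = trans (cong (_/ q) 1+m≡k*q) (m*n/n≡m k q)

∑𝟙[∣]-telescopes : ∀ q .{{_ : NonZero q}} lo len → ∑[ i < len ] 𝟙[ q ∣ lo + suc i ] + lo / q ≡ (lo + len) / q
∑𝟙[∣]-telescopes q lo zero    = cong (_/ q) (sym (+-identityʳ lo))
∑𝟙[∣]-telescopes q lo (suc n) = begin
  ∑< n f + f n + lo / q                                     ≡⟨ swap (∑< n f) (f n) (lo / q) ⟩
  ∑< n f + lo / q + f n                                     ≡⟨ cong (_+ f n) (∑𝟙[∣]-telescopes q lo n) ⟩
  (lo + n) / q + ((lo + suc n) / q ∸ pred (lo + suc n) / q) ≡⟨ cong (λ k → (lo + n) / q + ((lo + suc n) / q ∸ pred k / q)) (+-suc lo n) ⟩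
  (lo + n) / q + ((lo + suc n) / q ∸ (lo + n) / q)          ≡⟨ m+[n∸m]≡n (/-monoˡ-≤ q (+-monoʳ-≤ lo (n≤1+n n))) ⟩
  (lo + suc n) / q                                          ∎
  where
  open ≡-Reasoning
  f : ℕ → ℕ
  f i = 𝟙[ q ∣ lo + suc i ]
  swap : ∀ a b c → a + b + c ≡ a + c + b
  swap = solve-∀

∑𝟙[∣]≤[lo+len]/q : ∀ q .{{_ : NonZero q}} lo len → ∑[ i < len ] 𝟙[ q ∣ lo + suc i ] ≤ (lo + len) / q
∑𝟙[∣]≤[lo+len]/q q lo len = ≤-trans (m≤m+n _ (lo / q)) (≤-reflexive (∑𝟙[∣]-telescopes q lo len))

∑𝟙[∣]≤len/q+1 : ∀ q .{{_ : NonZero q}} lo len → ∑[ i < len ] 𝟙[ q ∣ lo + suc i ] ≤ len / q + 1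
∑𝟙[∣]≤len/q+1 q lo len = +-cancelʳ-≤ (lo / q) _ _ (begin
  ∑[ i < len ] 𝟙[ q ∣ lo + suc i ] + lo / q ≡⟨ ∑𝟙[∣]-telescopes q lo len ⟩
  (lo + len) / q                           ≤⟨ [m+n]/o≤m/o+n/o+1 lo len q ⟩
  lo / q + len / q + 1                     ≡⟨ rotate (lo / q) (len / q) ⟩
  len / q + 1 + lo / q                     ∎)
  where
  open ≤-Reasoning
  rotate : ∀ a b → a + b + 1 ≡ b + 1 + a
  rotate = solve-∀

-- Floor version of 1/((e+2)(e+1)) = 1/(e+1) - 1/(e+2).
/-telescope-step : ∀ Y e → Y / ((2 + e) * (1 + e)) + Y / (2 + e) ≤ Y / (1 + e)
/-telescope-step Y e = subst (_≤ Y / (1 + e)) (+-comm u v) (mul≤⇒≤/ (begin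
  (u + v) * (1 + e)         ≡⟨ *-distribʳ-+ (1 + e) u v ⟩
  u * (1 + e) + v * (1 + e) ≤⟨ +-monoʳ-≤ (u * (1 + e)) v*[1+e]≤u ⟩
  u * (1 + e) + u           ≡⟨ +-comm (u * (1 + e)) u ⟩
  u + u * (1 + e)           ≡⟨ *-suc u (1 + e) ⟨
  u * (2 + e)               ≤⟨ m/n*n≤m Y (2 + e) ⟩
  Y                         ∎))
  where
  open ≤-Reasoning
  u = Y / (2 + e)
  v = Y / ((2 + e) * (1 + e))
  v*[1+e]≤u : v * (1 + e) ≤ u
  v*[1+e]≤u = subst (λ w → w * (1 + e) ≤ u) (m/n/o≡m/[n*o] Y (2 + e) (1 + e)) (m/n*n≤m u (1 + e))
  mul≤⇒≤/ : ∀ {m} → m * (1 + e) ≤ Y → m ≤ Y / (1 + e)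
  mul≤⇒≤/ {m} le = subst (_≤ Y / (1 + e)) (m*n/n≡m m (1 + e)) (/-monoˡ-≤ (1 + e) le)

∑-/-telescopes : ∀ Y e len → ∑[ j < len ] Y / ((2 + e + j) * (1 + e + j)) + Y / (1 + e + len) ≤ Y / (1 + e)
∑-/-telescopes Y e zero    = ≤-reflexive (cong (λ k → Y / suc k) (+-identityʳ e))
∑-/-telescopes Y e (suc n) = begin
  ∑< n f + f n + Y / (1 + e + suc n)   ≡⟨ +-assoc (∑< n f) (f n) _ ⟩
  ∑< n f + (f n + Y / (1 + e + suc n)) ≡⟨ cong (λ k → ∑< n f + (f n + Y / suc k)) (+-suc e n) ⟩
  ∑< n f + (f n + Y / (2 + e + n))     ≤⟨ +-monoʳ-≤ (∑< n f) (/-telescope-step Y (e + n)) ⟩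
  ∑< n f + Y / (1 + e + n)             ≤⟨ ∑-/-telescopes Y e n ⟩
  Y / (1 + e)                          ∎
  where
  open ≤-Reasoning
  f : ℕ → ℕ
  f j = Y / ((2 + e + j) * (1 + e + j))

∑-/-squares≤ : ∀ Y e len → ∑[ j < len ] Y / ((2 + e + j) * (2 + e + j)) ≤ Y / (1 + e)
∑-/-squares≤ Y e len = begin
  ∑[ j < len ] Y / ((2 + e + j) * (2 + e + j))                     ≤⟨ ∑-mono-≤ len (λ j _ → /-monoʳ-≤ Y (*-monoʳ-≤ (2 + e + j) (n≤1+n (1 + e + j)))) ⟩
  ∑[ j < len ] Y / ((2 + e + j) * (1 + e + j))                     ≤⟨ m≤m+n _ _ ⟩
  ∑[ j < len ] Y / ((2 + e + j) * (1 + e + j)) + Y / (1 + e + len) ≤⟨ ∑-/-telescopes Y e len ⟩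
  Y / (1 + e)                                                    ∎
  where open ≤-Reasoning

∑-/-squares≤Y/4+Y/2 : ∀ Y n → ∑[ d < n ] Y / ((2 + d) * (2 + d)) ≤ Y / 4 + Y / 2
∑-/-squares≤Y/4+Y/2 Y zero    = z≤n
∑-/-squares≤Y/4+Y/2 Y (suc n) = begin
  ∑< (1 + n) f                 ≡⟨ ∑-split 1 n f ⟩
  Y / 4 + ∑[ d < n ] f (1 + d) ≤⟨ +-monoʳ-≤ (Y / 4) (∑-/-squares≤ Y 1 n) ⟩
  Y / 4 + Y / 2                ∎
  where
  open ≤-Reasoning
  f : ℕ → ℕ
  f d = Y / ((2 + d) * (2 + d))

∑-/-squares[8E]≤6E : ∀ E n → ∑[ d < n ] 8 * E / ((2 + d) * (2 + d)) ≤ 6 * E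
∑-/-squares[8E]≤6E E n = begin
  ∑[ d < n ] 8 * E / ((2 + d) * (2 + d)) ≤⟨ ∑-/-squares≤Y/4+Y/2 (8 * E) n ⟩
  8 * E / 4 + 8 * E / 2                  ≡⟨ cong₂ _+_ (exact-/ (2 * E) 4 (8E≡2E*4 E)) (exact-/ (4 * E) 2 (8E≡4E*2 E)) ⟩
  2 * E + 4 * E                          ≡⟨ 2E+4E≡6E E ⟩
  6 * E                                  ∎
  where
  open ≤-Reasoning
  exact-/ : ∀ u v .{{_ : NonZero v}} {w} → w ≡ u * v → w / v ≡ u
  exact-/ u v w≡u*v = trans (cong (_/ v) w≡u*v) (m*n/n≡m u v)
  8E≡2E*4 : ∀ e → 8 * e ≡ 2 * e * 4
  8E≡2E*4 = solve-∀
  8E≡4E*2 : ∀ e → 8 * e ≡ 4 * e * 2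
  8E≡4E*2 = solve-∀
  2E+4E≡6E : ∀ e → 2 * e + 4 * e ≡ 6 * e
  2E+4E≡6E = solve-∀

¬SF⇒1≤∑𝟙[square∣] : ∀ {m} U → 1 ≤ m → m ≤ U → ¬ SF m → 1 ≤ ∑[ d < U ] 𝟙[ (2 + d) * (2 + d) ∣ m ]
-- Deciding the sum avoids having to extract a prime square divisor from ¬ SF m.
¬SF⇒1≤∑𝟙[square∣] {m} U 1≤m m≤U ¬sf with 1 ≤? ∑[ d < U ] 𝟙[ (2 + d) * (2 + d) ∣ m ]
... | yes pos = pos
... | no ¬pos = ⊥-elim (¬sf (1≤m , λ p p-prime p²∣m →
        ¬pos (square∣⇒1≤∑ p (nonTrivial⇒n>1 p {{prime⇒nonTrivial p-prime}}) p²∣m)))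
  where
  square∣⇒1≤∑ : ∀ p → 2 ≤ p → p * p ∣ m → 1 ≤ ∑[ d < U ] 𝟙[ (2 + d) * (2 + d) ∣ m ]
  square∣⇒1≤∑ 1 (s≤s ()) _
  square∣⇒1≤∑ (suc (suc d)) _ p²∣m = ≤-trans (∣⇒1≤𝟙[∣] _ 1≤m p²∣m) (term≤∑ U _ d<U)
    where
    instance
      m≢0 : NonZero m
      m≢0 = >-nonZero 1≤m
    d<U : d < U
    d<U = ≤-trans (n≤1+n _) (≤-trans (m≤m*n (2 + d) (2 + d)) (≤-trans (∣⇒≤ p²∣m) m≤U))

∃prime∣ : ∀ {n} → 2 ≤ n → ∃ λ p → Prime p × p ∣ n
∃prime∣ {n@(suc _)} 2≤n with factorise n
... | record { factors = [] ; isFactorisation = n≡1 } = ⊥-elim (<⇒≢ 2≤n (sym n≡1))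
... | record { factors = p ∷ ps ; isFactorisation = n≡p*ps ; factorsPrime = p-prime ∷ _ } =
  p , p-prime , subst (p ∣_) (sym n≡p*ps) (m∣m*n (product ps))

square∣⇒¬SF : ∀ {d m} → 2 ≤ d → d * d ∣ m → ¬ SF m
square∣⇒¬SF 2≤d d²∣m (_ , squarefree) with ∃prime∣ 2≤d
... | p , p-prime , p∣d = squarefree p p-prime (∣-trans (*-pres-∣ p∣d p∣d) d²∣m)

count≤ : ∀ P x → count P x ≤ x
count≤ P zero    = z≤n
count≤ P (suc x) with P (suc x)
... | true  = s≤s (count≤ P x)
... | false = m≤n⇒m≤1+n (count≤ P x)

count≤B+count-above : ∀ P B x → count P x ≤ B + count (λ a → P a ∧ (B <ᵇ a)) x
count≤B+count-above P B zero = z≤n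
count≤B+count-above P B (suc x) with B <ᵇ suc x in B<ᵇ1+x
... | false = ≤-trans (count≤ P (suc x)) (≤-trans 1+x≤B (m≤m+n B _))
  where
  1+x≤B : suc x ≤ B
  1+x≤B = ≮⇒≥ (λ B<1+x → subst T B<ᵇ1+x (<⇒<ᵇ B<1+x))
... | true with P (suc x)
...   | true  = ≤-trans (s≤s (count≤B+count-above P B x)) (≤-reflexive (sym (+-suc B _)))
...   | false = count≤B+count-above P B x

count*≤count*+∑ : ∀ P (R : ℕ → ℕ) N s x → (∀ i → i < x → T (P (suc i)) → N ≤ s + R i) →
                  count P x * N ≤ count P x * s + ∑< x R
count*≤count*+∑ P R N s zero    _ = z≤n
count*≤count*+∑ P R N s (suc x) N≤s+R
  with P (suc x) in P[1+x] | count*≤count*+∑ P R N s x (λ i i<x → N≤s+R i (m<n⇒m<1+n i<x))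
... | false | IH = ≤-trans IH (≤-trans (m≤m+n _ (R x)) (≤-reflexive (+-assoc _ (∑< x R) (R x))))
... | true  | IH = begin
  N + c * N                  ≤⟨ +-mono-≤ (N≤s+R x ≤-refl (subst T (sym P[1+x]) tt)) IH ⟩
  s + R x + (c * s + ∑< x R) ≡⟨ regroup s (R x) (c * s) (∑< x R) ⟩
  s + c * s + (∑< x R + R x) ∎
  where
  open ≤-Reasoning
  c = count P x
  regroup : ∀ a b d e → a + b + (d + e) ≡ a + d + (e + b)
  regroup = solve-∀

module DensityZero (A : ℕ → Bool) (hasP : HasP (λ a → T (A a))) where

  P-bound : ℕ → ℕ
  P-bound j = proj₁ (hasP (suc j) (s≤s z≤n))

  threshold : ℕ → ℕ
  threshold N = ∑[ j < N ] P-bound j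

  above-threshold⇒¬SF : ∀ {N j a} → j < N → T (A a) → threshold N < a → ¬ SF (suc j + a)
  above-threshold⇒¬SF {N} {j} {a} j<N a∈A B<a sf = <⇒≱ B<a (≤-trans
    (proj₂ (hasP (suc j) (s≤s z≤n)) a a∈A (≤-trans (s≤s z≤n) B<a) sf)
    (term≤∑ N P-bound j<N))

  module Shifts (D N x : ℕ) where

    W : ℕ
    W = N + x

    small large : ℕ → ℕ
    small a = ∑[ j < N ] ∑[ d < D ] 𝟙[ (2 + d) * (2 + d) ∣ suc j + a ]
    large a = ∑[ j < N ] ∑[ l < W ] 𝟙[ (2 + D + l) * (2 + D + l) ∣ suc j + a ]

    N≤small+large : ∀ {a} → a ≤ x → T (A a) → threshold N < a → N ≤ small a + large a
    N≤small+large {a} a≤x a∈A B<a = begin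
      N                                                        ≡⟨ trans (∑-const N 1) (*-identityʳ N) ⟨
      ∑[ j < N ] 1                                             ≤⟨ ∑-mono-≤ N (λ j j<N → shift-¬SF j<N) ⟩
      ∑[ j < N ] ∑[ d < D + W ] sqDiv j d                      ≡⟨ ∑-cong N (λ j _ → ∑-split D W (sqDiv j)) ⟩
      ∑[ j < N ] (∑< D (sqDiv j) + ∑[ l < W ] sqDiv j (D + l)) ≡⟨ ∑-distrib-+ N _ _ ⟩
      small a + large a                                        ∎
      where
      open ≤-Reasoning
      sqDiv : ℕ → ℕ → ℕ
      sqDiv j d = 𝟙[ (2 + d) * (2 + d) ∣ suc j + a ]
      shift-¬SF : ∀ {j} → j < N → 1 ≤ ∑[ d < D + W ] sqDiv j d
      shift-¬SF j<N = ¬SF⇒1≤∑𝟙[square∣] (D + W) (s≤s z≤n)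
        (≤-trans (+-mono-≤ j<N a≤x) (m≤n+m W D)) (above-threshold⇒¬SF j<N a∈A B<a)

    small≤ : ∀ a → small a ≤ ∑[ d < D ] N / ((2 + d) * (2 + d)) + D
    small≤ a = begin
      small a                                                     ≡⟨ ∑-comm N D _ ⟩
      ∑[ d < D ] ∑[ j < N ] 𝟙[ (2 + d) * (2 + d) ∣ suc j + a ]    ≡⟨ ∑-cong D (λ d _ → ∑-cong N (λ j _ → cong 𝟙[ (2 + d) * (2 + d) ∣_] (+-comm (suc j) a))) ⟩
      ∑[ d < D ] ∑[ j < N ] 𝟙[ (2 + d) * (2 + d) ∣ a + suc j ]    ≤⟨ ∑-mono-≤ D (λ d _ → ∑𝟙[∣]≤len/q+1 _ a N) ⟩
      ∑[ d < D ] (N / ((2 + d) * (2 + d)) + 1)                     ≡⟨ ∑-distrib-+ D _ _ ⟩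
      ∑[ d < D ] N / ((2 + d) * (2 + d)) + ∑[ _ < D ] 1            ≡⟨ cong (∑[ d < D ] N / ((2 + d) * (2 + d)) +_) (trans (∑-const D 1) (*-identityʳ D)) ⟩
      ∑[ d < D ] N / ((2 + d) * (2 + d)) + D                       ∎
      where open ≤-Reasoning

    ∑large≤ : ∑[ i < x ] large (suc i) ≤ N * (W / suc D)
    ∑large≤ = begin
      ∑[ i < x ] large (suc i)                                              ≡⟨ ∑-comm x N _ ⟩
      ∑[ j < N ] ∑[ i < x ] ∑[ l < W ] 𝟙[ (2 + D + l) * (2 + D + l) ∣ suc j + suc i ] ≡⟨ ∑-cong N (λ j _ → ∑-comm x W _) ⟩
      ∑[ j < N ] ∑[ l < W ] ∑[ i < x ] 𝟙[ (2 + D + l) * (2 + D + l) ∣ suc j + suc i ] ≤⟨ ∑-mono-≤ N (λ j j<N → ∑-mono-≤ W (λ l _ → multiples≤ j<N l)) ⟩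
      ∑[ j < N ] ∑[ l < W ] W / ((2 + D + l) * (2 + D + l))                 ≤⟨ ∑-mono-≤ N (λ _ _ → ∑-/-squares≤ W D W) ⟩
      ∑[ j < N ] W / suc D                                                  ≡⟨ ∑-const N (W / suc D) ⟩
      N * (W / suc D)                                                       ∎
      where
      open ≤-Reasoning
      multiples≤ : ∀ {j} → j < N → ∀ l → ∑[ i < x ] 𝟙[ (2 + D + l) * (2 + D + l) ∣ suc j + suc i ] ≤ W / ((2 + D + l) * (2 + D + l))
      multiples≤ {j} j<N l = ≤-trans (∑𝟙[∣]≤[lo+len]/q _ (suc j) x) (/-monoˡ-≤ ((2 + D + l) * (2 + D + l)) (+-monoˡ-≤ x j<N))

  above : ℕ → ℕ → Bool
  above N a = A a ∧ (threshold N <ᵇ a)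

  count-above≤ : ∀ D x → count (above (8 * suc D)) x * suc D ≤ 8 * (8 * suc D + x)
  count-above≤ D x = +-cancelˡ-≤ (c * (7 * E)) _ _ (begin
    c * (7 * E) + c * E               ≡⟨ split-8 c E ⟩
    c * N                             ≤⟨ count*≤count*+∑ (above N) (large ∘ suc) N s x large-beyond ⟩
    c * s + ∑[ i < x ] large (suc i)  ≤⟨ +-mono-≤ (*-monoʳ-≤ c s≤7E) ∑large≤ ⟩
    c * (7 * E) + N * (W / E)         ≡⟨ cong (c * (7 * E) +_) (regroup E (W / E)) ⟩
    c * (7 * E) + 8 * (W / E * E)     ≤⟨ +-monoʳ-≤ (c * (7 * E)) (*-monoʳ-≤ 8 (m/n*n≤m W E)) ⟩
    c * (7 * E) + 8 * W               ∎)
    where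
    open ≤-Reasoning
    E = suc D
    N = 8 * E
    open Shifts D N x
    c = count (above N) x
    s = ∑[ d < D ] N / ((2 + d) * (2 + d)) + D
    large-beyond : ∀ i → i < x → T (above N (suc i)) → N ≤ s + large (suc i)
    large-beyond i i<x above with Equivalence.to T-∧ above
    ... | a∈A , B<ᵇa = ≤-trans (N≤small+large i<x a∈A (<ᵇ⇒< _ _ B<ᵇa)) (+-monoˡ-≤ _ (small≤ (suc i)))
    s≤7E : s ≤ 7 * E
    s≤7E = ≤-trans (+-mono-≤ (∑-/-squares[8E]≤6E E D) (n≤1+n D)) (≤-reflexive (sum-7 E))
      where
      sum-7 : ∀ e → 6 * e + e ≡ 7 * e
      sum-7 = solve-∀
    split-8 : ∀ c E → c * (7 * E) + c * E ≡ c * (8 * E)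
    split-8 = solve-∀
    regroup : ∀ E w → 8 * E * w ≡ 8 * (w * E)
    regroup = solve-∀

  density0 : Density0 A
  density0 zero ()
  density0 k@(suc k') _ = X , k*count≤x
    where
    -- so that suc D reduces to 16 * k
    D = k' + 15 * k
    N = 8 * suc D
    B = threshold N
    X = 2 * k * B + N
    k*count≤x : ∀ x → X ≤ x → k * count A x ≤ x
    k*count≤x x X≤x = *-cancelˡ-≤ 16 (begin
      16 * (k * count A x)      ≤⟨ *-monoʳ-≤ 16 (*-monoʳ-≤ k (count≤B+count-above A B x)) ⟩
      16 * (k * (B + c))        ≡⟨ distribute k B c ⟩
      16 * k * B + c * (16 * k) ≤⟨ +-monoʳ-≤ (16 * k * B) (count-above≤ D x) ⟩
      16 * k * B + 8 * (N + x)  ≡⟨ regroup k B N x ⟩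
      8 * X + 8 * x             ≤⟨ +-monoˡ-≤ (8 * x) (*-monoʳ-≤ 8 X≤x) ⟩
      8 * x + 8 * x             ≡⟨ double x ⟩
      16 * x                    ∎)
      where
      open ≤-Reasoning
      c = count (above N) x
      distribute : ∀ k B c → 16 * (k * (B + c)) ≡ 16 * k * B + c * (16 * k)
      distribute = solve-∀
      regroup : ∀ k B N x → 16 * k * B + 8 * (N + x) ≡ 8 * (2 * k * B + N) + 8 * x
      regroup = solve-∀
      double : ∀ x → 8 * x + 8 * x ≡ 16 * x
      double = solve-∀

module _ {ℓ} {P : ℕ → Set ℓ} (P? : Decidable P) where

  largest : ℕ → ℕ
  largest zero    = 0
  largest (suc K) with P? (suc K)
  ... | yes _ = suc K
  ... | no  _ = largest K

  largest-satisfies : ∀ K → largest K ≡ 0 ⊎ P (largest K)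
  largest-satisfies zero    = inj₁ refl
  largest-satisfies (suc K) with P? (suc K)
  ... | yes p = inj₂ p
  ... | no  _ = largest-satisfies K

  largest-maximal : ∀ {n K} → n ≤ K → P n → n ≤ largest K
  largest-maximal {K = zero}  z≤n _ = z≤n
  largest-maximal {n} {suc K} n≤1+K pn with P? (suc K)
  ... | yes _ = n≤1+K
  ... | no ¬p with m≤n⇒m<n∨m≡n n≤1+K
  ...   | inj₁ n<1+K = largest-maximal (≤-pred n<1+K) pn
  ...   | inj₂ refl  = ⊥-elim (¬p pn)

modulus : ℕ → ℕ
modulus zero    = 1
modulus (suc L) = modulus L * (suc (modulus L) * suc (modulus L))

modulus≢0 : ∀ L → NonZero (modulus L)
modulus≢0 zero    = _
modulus≢0 (suc L) = m*n≢0 (modulus L) _ {{modulus≢0 L}}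

-- Since (M + 2) M = (M + 1)² - 1, the new term is ≡ 0 mod M and ≡ -(r + L + 1) mod (M + 1)².
residue : ℕ → ℕ
residue zero    = 0
residue (suc L) = residue L + (residue L + suc L) * (2 + modulus L) * modulus L

residue-spec : ∀ L t {k} → k < L → suc (modulus k) * suc (modulus k) ∣ residue L + t * modulus L + suc k
residue-spec (suc L) t {k} k<1+L with m≤n⇒m<n∨m≡n (≤-pred k<1+L)
... | inj₂ refl = divides (residue L + suc L + t * modulus L) (new-level (residue L) (suc L) (modulus L) t)
  where
  new-level : ∀ r n m t → r + (r + n) * (2 + m) * m + t * (m * (suc m * suc m)) + n ≡ (r + n + t * m) * (suc m * suc m)
  new-level = solve-∀
... | inj₁ k<L = subst (suc (modulus k) * suc (modulus k) ∣_)
        (sym (old-level (residue L) (suc L) (modulus L) t (suc k)))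
        (residue-spec L ((residue L + suc L) * (2 + modulus L) + t * (suc (modulus L) * suc (modulus L))) k<L)
  where
  old-level : ∀ r n m t s → r + (r + n) * (2 + m) * m + t * (m * (suc m * suc m)) + s
                          ≡ r + ((r + n) * (2 + m) + t * (suc m * suc m)) * m + s
  old-level = solve-∀

gap : ℕ → ℕ
gap L = residue L + modulus L

module _ (L : ℕ) where
  private instance
    _ : NonZero (modulus L)
    _ = modulus≢0 L

  nextInClass : ℕ → ℕ
  nextInClass p = residue L + suc (p / modulus L) * modulus L

  p<nextInClass : ∀ p → p < nextInClass p
  p<nextInClass p = <-≤-trans (m<[1+m/n]*n p (modulus L)) (m≤n+m _ (residue L))

  nextInClass≤p+gap : ∀ p → nextInClass p ≤ p + gap L
  nextInClass≤p+gap p = begin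
    residue L + (modulus L + p / modulus L * modulus L) ≤⟨ +-monoʳ-≤ (residue L) (+-monoʳ-≤ (modulus L) (m/n*n≤m p (modulus L))) ⟩
    residue L + (modulus L + p)                         ≡⟨ rotate (residue L) (modulus L) p ⟩
    p + (residue L + modulus L)                         ∎
    where
    open ≤-Reasoning
    rotate : ∀ x y z → x + (y + z) ≡ z + (x + y)
    rotate = solve-∀

  nextInClass-¬SF : ∀ p {k} → k < L → ¬ SF (suc k + nextInClass p)
  nextInClass-¬SF p {k} k<L = square∣⇒¬SF (s≤s (>-nonZero⁻¹ (modulus k) {{modulus≢0 k}}))
    (subst (suc (modulus k) * suc (modulus k) ∣_) (+-comm _ (suc k)) (residue-spec L (suc (p / modulus L)) k<L))

strictlyIncreasing⇒monotone : ∀ (s : ℕ → ℕ) → (∀ i → s i < s (suc i)) → ∀ {i j} → i ≤ j → s i ≤ s j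
strictlyIncreasing⇒monotone s s-inc {i} {zero}  z≤n  = ≤-refl
strictlyIncreasing⇒monotone s s-inc {i} {suc j} i≤1+j with m≤n⇒m<n∨m≡n i≤1+j
... | inj₁ i<1+j = ≤-trans (strictlyIncreasing⇒monotone s s-inc (≤-pred i<1+j)) (<⇒≤ (s-inc j))
... | inj₂ refl  = ≤-refl

module Construction (f : ℕ → ℕ) (f-pos : ∀ j → 1 ≤ j → 1 ≤ f j) (f→∞ : TendsToInfinity f) where

  f≥from : ℕ → ℕ
  f≥from m = proj₁ (f→∞ m)

  level : ℕ → ℕ
  level j = largest (λ L → f≥from (gap L) ≤? suc j) j

  gap[level]≤ : ∀ {j k} → suc j ≤ k → gap (level j) ≤ f k
  gap[level]≤ {j} {k} 1+j≤k with largest-satisfies (λ L → f≥from (gap L) ≤? suc j) j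
  ... | inj₁ level≡0 = subst (λ L → gap L ≤ f k) (sym level≡0) (f-pos k (≤-trans (s≤s z≤n) 1+j≤k))
  ... | inj₂ from≤1+j   = proj₂ (f→∞ (gap (level j))) k (≤-trans from≤1+j 1+j≤k)

  ≤level : ∀ {n j} → n ≤ j → f≥from (gap n) ≤ suc j → n ≤ level j
  ≤level {j = j} = largest-maximal (λ L → f≥from (gap L) ≤? suc j)

  b : ℕ → ℕ
  b zero    = 0
  b (suc i) = nextInClass (level i) (b i)

  a : ℕ → ℕ
  a i = b (suc i)

  a-increasing : ∀ i → a i < a (suc i)
  a-increasing i = p<nextInClass (level (suc i)) (a i)

  a-positive : ∀ i → 1 ≤ a i
  a-positive i = ≤-<-trans z≤n (p<nextInClass (level i) (b i))

  b≤i*f : ∀ {i k} → i ≤ k → b i ≤ i * f k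
  b≤i*f {zero}      _     = z≤n
  b≤i*f {suc i} {k} 1+i≤k = begin
    nextInClass (level i) (b i) ≤⟨ nextInClass≤p+gap (level i) (b i) ⟩
    b i + gap (level i)         ≤⟨ +-mono-≤ (b≤i*f (<⇒≤ 1+i≤k)) (gap[level]≤ 1+i≤k) ⟩
    i * f k + f k               ≡⟨ +-comm (i * f k) (f k) ⟩
    suc i * f k                 ∎
    where open ≤-Reasoning

  a-hasP : HasP (λ m → ∃ λ i → a i ≡ m)
  a-hasP zero ()
  a-hasP (suc k) _ = a I , λ { _ (i , refl) _ sf → a-bounded i sf }
    where
    I = suc k + f≥from (gap (suc k))
    a-bounded : ∀ i → SF (suc k + a i) → a i ≤ a I
    a-bounded i sf with i ≤? I
    ... | yes i≤I = strictlyIncreasing⇒monotone a a-increasing i≤I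
    ... | no  i≰I = ⊥-elim (nextInClass-¬SF (level i) (b i) k<level sf)
      where
      I≤i : I ≤ i
      I≤i = <⇒≤ (≰⇒> i≰I)
      k<level : k < level i
      k<level = ≤level (≤-trans (m≤m+n (suc k) _) I≤i) (≤-trans (m≤n+m _ (suc k)) (≤-trans I≤i (n≤1+n i)))

theorem1p2 : ((A : ℕ → Bool) → HasP (λ a → T (A a)) → Density0 A)
  × ((f : ℕ → ℕ) → (∀ j → 1 ≤ j → 1 ≤ f j) → TendsToInfinity f →
      ∃ λ (a : ℕ → ℕ) →
        (∀ i → 1 ≤ a i)
        × (∀ i → a i < a (suc i))
        × HasP (λ m → ∃ λ i → a i ≡ m)
        × (∀ i → a i ≤ suc i * f (suc i)))
theorem1p2 = DensityZero.density0 , λ f f-pos f→∞ → let open Construction f f-pos f→∞ in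
  a , a-positive , a-increasing , a-hasP , λ i → b≤i*f ≤-refl
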